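{- Let $G$ be a nontrivial finite cyclic group and $a\in G$ an element other than the identity. Let $H(a)$ be the subgroup of $G$ of largest cardinality among the subgroups not containing $a$. Write $|G|=\prod_{j=1}^k p_j^{\alpha_j}$ and $\mathrm{ord}_G(a)=\prod_{j=1}^s p_j^{\beta_j}$ (prime factorizations with distinct primes $p_j$, $s\le k$, $\alpha_j,\beta_j\ge1$), and put $\mathscr P(G,a)=\min_{1\le j\le s}p_j^{\alpha_j-\beta_j+1}$. Then $\mathscr P(G,a)\,|H(a)|=|G|$.
   Context: $H(a)$ is well defined because every subgroup of a finite cyclic group is determined by its cardinality. $\mathrm{ord}_G(a)$ is the order of $a$ in $G$. -}

module Defs where

open import Level using (_⊔_)
open import Algebra.Bundles using (Group)
open import Data.Nat using (ℕ; zero; suc; _+_; _^_; _∸_; _≤_; _<_)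
open import Data.Nat.Divisibility using (_∣_)
open import Data.Nat.Primality using (Prime)
open import Data.Fin using (Fin)
open import Data.Fin.Subset using (Subset; _∈_)
open import Data.Product using (Σ; ∃; _×_)
open import Function.Bundles using (Inverse)
open import Relation.Binary.PropositionalEquality using (_≡_)
import Relation.Binary.PropositionalEquality as ≡
open import Relation.Nullary using (¬_)

module _ {c ℓ} (G : Group c ℓ) where
  open Group G

  pow : Carrier → ℕ → Carrier
  pow x zero    = ε
  pow x (suc k) = x ∙ pow x k

  -- G is cyclic: some g generates G.  We use ℕ-powers; for a finite group
  -- (the only case used) this is equivalent to generation by ℤ-powers.
  IsCyclic : Set (c ⊔ ℓ)
  IsCyclic = ∃ λ g → ∀ x → ∃ λ k → x ≈ pow g k

  HasOrder : Carrier → ℕ → Set ℓ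
  HasOrder a m = (0 < m) × (pow a m ≈ ε) × (∀ k → 0 < k → k < m → ¬ (pow a k ≈ ε))

  -- |G| = n : an explicit bijection between Fin n and (the setoid of) G
  Enumeration : ℕ → Set (c ⊔ ℓ)
  Enumeration n = Inverse (≡.setoid (Fin n)) setoid

  module _ {n : ℕ} (e : Enumeration n) where
    open Inverse e using (from)

    -- a subset of G, represented through the enumeration as a Subset n
    _∈G_ : Carrier → Subset n → Set
    x ∈G S = from x ∈ S

    record IsSubgroup (S : Subset n) : Set c where
      field
        ε-closed : ε ∈G S
        ∙-closed : ∀ x y → x ∈G S → y ∈G S → (x ∙ y) ∈G S
        ⁻¹-closed : ∀ x → x ∈G S → (x ⁻¹) ∈G S

Multiplicity : ℕ → ℕ → ℕ → Set
Multiplicity p n α = (p ^ α ∣ n) × ¬ (p ^ suc α ∣ n)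

ScriptPTerm : ℕ → ℕ → ℕ → ℕ → Set
ScriptPTerm n m p t =
  Prime p × (p ∣ m) ×
  (Σ ℕ λ α → Σ ℕ λ β → Multiplicity p n α × Multiplicity p m β × (t ≡ p ^ (α ∸ β + 1)))

IsScriptP : ℕ → ℕ → ℕ → Set
IsScriptP n m v =
  (∃ λ p → ScriptPTerm n m p v) × (∀ p t → ScriptPTerm n m p t → v ≤ t)

{-# OPTIONS --safe #-}
module Submission where

-- Through the discrete logarithm to base a generator g, G is ℤ/n. A subgroup H is then the
-- set of elements whose logarithm is a multiple of the least positive k with g^k ∈ H; this k
-- is the index c of H, so c·|H| = n. Writing n = m q, log a is a multiple of q, hence a ∉ H
-- forces c ∤ q. Since c ∣ m q, some prime p ∣ m then occurs in c with exponent at least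
-- v_p(q) + 1 = α − β + 1, so 𝒫 ≤ c and 𝒫·|H| ≤ n. Conversely, for the prime p attaining 𝒫
-- we have 𝒫 ∣ n and m ∤ n/𝒫 (as p^β ∤ n/𝒫), so the subgroup of elements whose logarithm is a
-- multiple of 𝒫 has n/𝒫 elements and misses a; maximality of H gives n ≤ 𝒫·|H|.

open import Level using (_⊔_)
open import Algebra.Bundles using (Group)
import Algebra.Properties.Group as GroupProperties
import Algebra.Properties.Monoid.Mult as MonoidMultProperties
open import Data.Bool.Properties using (T-≡)
open import Data.Fin.Base using (Fin; zero; suc; toℕ; fromℕ<)
import Data.Fin.Properties as Finₚ
open Finₚ using (injective⇒≤; pigeonhole; toℕ-injective; toℕ<n; fromℕ<-injective)
open import Data.Fin.Subset using (Subset; _∈_; ∣_∣; inside; outside)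
open import Data.Fin.Subset.Properties using (_∈?_; ⊆-antisym)
open import Data.List.Base using ([]; _∷_)
open import Data.List.Relation.Unary.All using (All; []; _∷_)
open import Data.Nat.Base hiding (_⊔_)
open import Data.Nat.Divisibility
open import Data.Nat.DivMod
open import Data.Nat.Induction using (<-wellFounded)
open import Data.Nat.ListAction using (product)
open import Data.Nat.Primality
open import Data.Nat.Primality.Factorisation using (factorise)
open import Data.Nat.Properties
open import Algebra.Properties.CommutativeSemigroup *-commutativeSemigroup
  using (interchange; x∙yz≈z∙xy)
open import Data.Product using (∃; _×_; _,_; proj₁; proj₂)
open import Data.Sum using (inj₁; inj₂; [_,_]′)
open import Data.Vec.Base using (_∷_; here; there; tabulate; lookup)
open import Data.Vec.Properties using (lookup⇒[]=; []=⇒lookup; lookup∘tabulate)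
open import Function using (_∘_; id)
open import Function.Bundles using (Inverse; module Equivalence)
open import Function.Definitions using (Injective)
open import Induction.WellFounded using (Acc; acc)
open import Relation.Binary.PropositionalEquality using (_≡_; refl; module ≡-Reasoning)
import Relation.Binary.PropositionalEquality as ≡
import Relation.Binary.Reasoning.Setoid as ≈-Reasoning
open import Relation.Nullary using (¬_; Dec; yes; no; contradiction; _×-dec_)
open import Relation.Nullary.Decidable
  using (does; isYes; isYes≗does; dec-true; toWitness; map′)
open import Relation.Unary using (Pred; Decidable)

open import Defs

^-monoʳ-∣ : ∀ p {i j} → i ≤ j → p ^ i ∣ p ^ j
^-monoʳ-∣ p {i} {j} i≤j = divides (p ^ (j ∸ i)) (begin
  p ^ j               ≡⟨ ≡.cong (p ^_) (m+[n∸m]≡n i≤j) ⟨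
  p ^ (i + (j ∸ i))   ≡⟨ ^-distribˡ-+-* p i (j ∸ i) ⟩
  p ^ i * p ^ (j ∸ i) ≡⟨ *-comm (p ^ i) _ ⟩
  p ^ (j ∸ i) * p ^ i ∎)
  where open ≡-Reasoning

module _ {p : ℕ} where

  multiplicity-zero : ∀ {x} → ¬ p ∣ x → Multiplicity p x 0
  multiplicity-zero {x} p∤x = 1∣ x , p∤x ∘ ≡.subst (_∣ x) (*-identityʳ p)

  multiplicity-≤ : ∀ {x α β} → Multiplicity p x α → p ^ β ∣ x → β ≤ α
  multiplicity-≤ {β = β} (_ , p^1+α∤x) p^β∣x =
    ≮⇒≥ (λ α<β → p^1+α∤x (∣-trans (^-monoʳ-∣ p α<β) p^β∣x))

  multiplicity⇒cofactor : ∀ {x α} → Multiplicity p x α → ∃ λ y → x ≡ p ^ α * y × ¬ p ∣ y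
  multiplicity⇒cofactor {α = α} (divides y refl , p^1+α∤x) =
    y , *-comm y (p ^ α) , p^1+α∤x ∘ *-monoˡ-∣ (p ^ α)

  cofactor⇒multiplicity : .{{NonZero p}} → ∀ {y α} → ¬ p ∣ y → Multiplicity p (p ^ α * y) α
  cofactor⇒multiplicity {y} {α} p∤y = m∣m*n y , p∤y ∘ *-cancelˡ-∣ (p ^ α) {{m^n≢0 p α}}
    ∘ ≡.subst (_∣ p ^ α * y) (*-comm p (p ^ α))

  module _ (pp : Prime p) where
    private instance _ = prime⇒nonZero pp

    multiplicity-* : ∀ {x y α β} → Multiplicity p x α → Multiplicity p y β →
                     Multiplicity p (x * y) (α + β)
    multiplicity-* {α = α} {β} mx my
      with multiplicity⇒cofactor {α = α} mx | multiplicity⇒cofactor {α = β} my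
    ... | x′ , refl , p∤x′ | y′ , refl , p∤y′ =
      ≡.subst (λ z → Multiplicity p z (α + β)) eq (cofactor⇒multiplicity {α = α + β} p∤x′y′)
      where
      p∤x′y′ : ¬ p ∣ x′ * y′
      p∤x′y′ = [ p∤x′ , p∤y′ ]′ ∘ euclidsLemma x′ y′ pp
      eq : p ^ (α + β) * (x′ * y′) ≡ p ^ α * x′ * (p ^ β * y′)
      eq = ≡.trans (≡.cong (_* (x′ * y′)) (^-distribˡ-+-* p α β)) (interchange (p ^ α) _ x′ y′)

    multiplicity-self : Multiplicity p p 1
    multiplicity-self = ≡.subst (λ z → Multiplicity p z 1)
      (≡.trans (*-identityʳ (p * 1)) (*-identityʳ p))
      (cofactor⇒multiplicity {α = 1} (λ p∣1 → ¬prime[1] (≡.subst Prime (∣1⇒≡1 p∣1) pp)))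

    multiplicity-exists : ∀ x → .{{NonZero x}} → ∃ (Multiplicity p x)
    multiplicity-exists x = go x (<-wellFounded x)
      where
      go : ∀ x → .{{NonZero x}} → Acc _<_ x → ∃ (Multiplicity p x)
      go x (acc rec) with p ∣? x
      ... | no p∤x = 0 , multiplicity-zero p∤x
      ... | yes (divides y refl) =
        let instance _ = m*n≢0⇒m≢0 y
            γ , mγ = go y (rec (m<m*n y p (nonTrivial⇒n>1 p {{prime⇒nonTrivial pp}})))
        in suc γ , ≡.subst (λ z → Multiplicity p z (suc γ)) (*-comm p y)
                     (multiplicity-* {α = 1} {γ} multiplicity-self mγ)

prime∣prime⇒≡ : ∀ {p r} → Prime p → Prime r → r ∣ p → r ≡ p
prime∣prime⇒≡ pp pr r∣p = [ (λ r≡1 → contradiction (≡.subst Prime r≡1 pr) ¬prime[1]) , id ]′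
  (prime⇒irreducible pp r∣p)

Excess : ℕ → ℕ → ℕ → Set
Excess m q c = ∃ λ p → Prime p × p ∣ m × ∃ λ γ → Multiplicity p q γ × p ^ suc γ ∣ c

excess-* : ∀ {m q c p} → Prime p → Excess m q c → Excess m (p * q) (p * c)
excess-* {p = p} pp (r , pr , r∣m , γ , mult , r^1+γ∣c) with r ≟ p
... | yes refl = r , pr , r∣m , suc γ , multiplicity-* pr {α = 1} {γ} (multiplicity-self pr) mult ,
                 *-monoʳ-∣ r r^1+γ∣c
... | no r≢p   = r , pr , r∣m , γ , multiplicity-* pr {α = 0} {γ} (multiplicity-zero r∤p) mult ,
                 ∣n⇒∣m*n p r^1+γ∣c
  where r∤p = r≢p ∘ prime∣prime⇒≡ pp pr

excess : ∀ {m q c} → .{{NonZero c}} → c ∣ m * q → ¬ c ∣ q → Excess m q c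
excess {m} {c = c} c∣mq c∤q with factorise c
... | record { factors = ps ; isFactorisation = refl ; factorsPrime = pps } = go ps pps c∣mq c∤q
  where
  go : ∀ {q} ps → All Prime ps → product ps ∣ m * q → ¬ product ps ∣ q → Excess m q (product ps)
  go [] _ _ 1∤q = contradiction (1∣ _) 1∤q
  go {q} (p ∷ ps) (pp ∷ pps) c∣mq c∤q with p ∣? q
  ... | no p∤q = p , pp , p∣m , 0 , multiplicity-zero p∤q , *-monoʳ-∣ p (1∣ product ps)
    where p∣m = [ id , (λ p∣q → contradiction p∣q p∤q) ]′
                  (euclidsLemma m q pp (∣-trans (m∣m*n (product ps)) c∣mq))
  ... | yes (divides q′ refl) = ≡.subst (λ z → Excess m z (p * product ps)) (*-comm p q′)
        (excess-* pp (go ps pps c′∣mq′ c′∤q′))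
    where
    instance _ = prime⇒nonZero pp
    c′∣mq′ : product ps ∣ m * q′
    c′∣mq′ = *-cancelˡ-∣ p (≡.subst (p * product ps ∣_) (x∙yz≈z∙xy m q′ p) c∣mq)
    c′∤q′ : ¬ product ps ∣ q′
    c′∤q′ = c∤q ∘ ≡.subst (p * product ps ∣_) (*-comm p q′) ∘ *-monoʳ-∣ p

scriptP-≤ : ∀ {n m q c v} → .{{NonZero m}} → .{{NonZero c}} →
            n ≡ m * q → c ∣ n → ¬ c ∣ q → IsScriptP n m v → v ≤ c
scriptP-≤ {m = m} {q} {c} {v} refl c∣n c∤q (_ , minimal) with excess c∣n c∤q
... | p , pp , p∣m , γ , mult-q , p^1+γ∣c with multiplicity-exists pp m
...   | β , mult-m = begin
  v                   ≤⟨ minimal p _ term ⟩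
  p ^ (β + γ ∸ β + 1) ≡⟨ ≡.cong (p ^_) (≡.trans (≡.cong (_+ 1) (m+n∸m≡n β γ)) (+-comm γ 1)) ⟩
  p ^ suc γ           ≤⟨ ∣⇒≤ p^1+γ∣c ⟩
  c                   ∎
  where
  open ≤-Reasoning
  term : ScriptPTerm (m * q) m p (p ^ (β + γ ∸ β + 1))
  term = pp , p∣m , β + γ , β , multiplicity-* pp {α = β} {γ} mult-m mult-q , mult-m , refl

scriptPTerm-cofactor : ∀ {n m p t} → m ∣ n → ScriptPTerm n m p t → ∃ λ w → n ≡ t * w × ¬ m ∣ w
scriptPTerm-cofactor {n} {m} {p} m∣n (pp , p∣m , α , β , mult-n , mult-m , refl) =
  quotient t∣n , m∣n⇒n≡m*quotient t∣n , m∤w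
  where
  1≤β : 1 ≤ β
  1≤β = multiplicity-≤ mult-m (≡.subst (_∣ m) (≡.sym (*-identityʳ p)) p∣m)
  β≤α : β ≤ α
  β≤α = multiplicity-≤ mult-n (∣-trans (proj₁ mult-m) m∣n)
  t∣n : p ^ (α ∸ β + 1) ∣ n
  t∣n = ∣-trans (^-monoʳ-∣ p (≡.subst (_≤ α) (+-comm 1 (α ∸ β)) (∸-monoʳ-< 1≤β β≤α))) (proj₁ mult-n)
  m∤w : ¬ m ∣ quotient t∣n
  m∤w m∣w = proj₂ mult-n (≡.subst₂ _∣_ t*p^β≡p^1+α (≡.sym (m∣n⇒n≡m*quotient t∣n))
    (*-monoʳ-∣ (p ^ (α ∸ β + 1)) (∣-trans (proj₁ mult-m) m∣w)))
    where
    t*p^β≡p^1+α : p ^ (α ∸ β + 1) * p ^ β ≡ p ^ suc α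
    t*p^β≡p^1+α = ≡.trans (≡.sym (^-distribˡ-+-* p (α ∸ β + 1) β))
      (≡.cong (p ^_) (≡.trans (≡.cong (_+ β) (+-comm (α ∸ β) 1)) (≡.cong suc (m∸n+n≡m β≤α))))

module _ {n ℓ} {P : Pred (Fin n) ℓ} (P? : Decidable P) where

  subsetOf : Subset n
  subsetOf = tabulate (does ∘ P?)

  ∈-subsetOf⁺ : ∀ {j} → P j → j ∈ subsetOf
  ∈-subsetOf⁺ {j} Pj =
    lookup⇒[]= j subsetOf (≡.trans (lookup∘tabulate (does ∘ P?) j) (dec-true (P? j) Pj))

  ∈-subsetOf⁻ : ∀ {j} → j ∈ subsetOf → P j
  ∈-subsetOf⁻ {j} j∈ = toWitness {a? = P? j} (Equivalence.from T-≡ (begin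
    isYes (P? j)           ≡⟨ isYes≗does (P? j) ⟩
    does (P? j)            ≡⟨ lookup∘tabulate (does ∘ P?) j ⟨
    lookup subsetOf j      ≡⟨ []=⇒lookup j∈ ⟩
    inside                 ∎))
    where open ≡-Reasoning

rank : ∀ {n} (p : Subset n) {x} → x ∈ p → Fin ∣ p ∣
rank (inside  ∷ p) here        = zero
rank (inside  ∷ p) (there x∈p) = suc (rank p x∈p)
rank (outside ∷ p) (there x∈p) = rank p x∈p

select : ∀ {n} (p : Subset n) → Fin ∣ p ∣ → Fin n
select (inside  ∷ p) zero    = zero
select (inside  ∷ p) (suc i) = suc (select p i)
select (outside ∷ p) i       = suc (select p i)

select-∈ : ∀ {n} (p : Subset n) i → select p i ∈ p
select-∈ (inside  ∷ p) zero    = here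
select-∈ (inside  ∷ p) (suc i) = there (select-∈ p i)
select-∈ (outside ∷ p) i       = there (select-∈ p i)

select-rank : ∀ {n} (p : Subset n) {x} (x∈p : x ∈ p) → select p (rank p x∈p) ≡ x
select-rank (inside  ∷ p) here        = refl
select-rank (inside  ∷ p) (there x∈p) = ≡.cong suc (select-rank p x∈p)
select-rank (outside ∷ p) (there x∈p) = ≡.cong suc (select-rank p x∈p)

select-injective : ∀ {n} (p : Subset n) → Injective _≡_ _≡_ (select p)
select-injective (inside  ∷ p) {zero}  {zero}  _  = refl
select-injective (inside  ∷ p) {suc i} {suc j} eq =
  ≡.cong suc (select-injective p (Finₚ.suc-injective eq))
select-injective (outside ∷ p)                 eq = select-injective p (Finₚ.suc-injective eq)

rank-injective : ∀ {n} (p : Subset n) {x y} (x∈p : x ∈ p) (y∈p : y ∈ p) →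
                 rank p x∈p ≡ rank p y∈p → x ≡ y
rank-injective p {x} {y} x∈p y∈p eq = begin
  x                       ≡⟨ select-rank p x∈p ⟨
  select p (rank p x∈p)   ≡⟨ ≡.cong (select p) eq ⟩
  select p (rank p y∈p)   ≡⟨ select-rank p y∈p ⟩
  y                       ∎
  where open ≡-Reasoning

module _ {n} {p : Subset n} where

  injective⇒≤∣p∣ : ∀ {a} (f : Fin a → Fin n) → (∀ i → f i ∈ p) → Injective _≡_ _≡_ f → a ≤ ∣ p ∣
  injective⇒≤∣p∣ f f∈p f-inj = injective⇒≤ (f-inj ∘ rank-injective p (f∈p _) (f∈p _))

  injectiveOn⇒∣p∣≤ : ∀ {b} (f : Fin n → Fin b) → (∀ {x y} → x ∈ p → y ∈ p → f x ≡ f y → x ≡ y) →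
                      ∣ p ∣ ≤ b
  injectiveOn⇒∣p∣≤ f f-inj = injective⇒≤ (select-injective p ∘ f-inj (select-∈ p _) (select-∈ p _))

Least : ∀ {ℓ} → Pred ℕ ℓ → ℕ → Set ℓ
Least P k = P k × (∀ {j} → j < k → ¬ P j)

least : ∀ {ℓ} {P : Pred ℕ ℓ} → Decidable P → ∀ {k} → P k → ∃ (Least P)
least {P = P} P? {k} Pk = go k (<-wellFounded k) Pk
  where
  go : ∀ k → Acc _<_ k → P k → ∃ (Least P)
  go k (acc rec) Pk with anyUpTo? P? k
  ... | no  none             = k , Pk , λ j<k Pj → none (_ , j<k , Pj)
  ... | yes (j , j<k , Pj)   = go j (rec j<k) Pj

module _ {c ℓ} (G : Group c ℓ) where
  open Group G hiding (refl)
  open GroupProperties G using (identityʳ-unique)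
  open MonoidMultProperties monoid using (×-homo-+; ×-assocˡ; ×-congʳ)
    renaming (_×_ to _×ᴹ_)

  Generates : Carrier → Set (c ⊔ ℓ)
  Generates g = ∀ x → ∃ λ k → x ≈ pow G g k

  pow≡× : ∀ x k → pow G x k ≡ k ×ᴹ x
  pow≡× x zero    = refl
  pow≡× x (suc k) = ≡.cong (x ∙_) (pow≡× x k)

  pow-+ : ∀ x i j → pow G x (i + j) ≈ pow G x i ∙ pow G x j
  pow-+ x i j rewrite pow≡× x (i + j) | pow≡× x i | pow≡× x j = ×-homo-+ x i j

  pow-* : ∀ x i j → pow G x (i * j) ≈ pow G (pow G x j) i
  pow-* x i j rewrite pow≡× x (i * j) | pow≡× (pow G x j) i | pow≡× x j = sym (×-assocˡ x i j)

  pow-cong : ∀ {x y} k → x ≈ y → pow G x k ≈ pow G y k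
  pow-cong {x} {y} k x≈y rewrite pow≡× x k | pow≡× y k = ×-congʳ k x≈y

  pow-ε : ∀ k → pow G ε k ≈ ε
  pow-ε zero    = Group.refl G
  pow-ε (suc k) = trans (identityˡ _) (pow-ε k)

  pow-∸ : ∀ {x i j} → i ≤ j → pow G x i ≈ pow G x j → pow G x (j ∸ i) ≈ ε
  pow-∸ {x} {i} {j} i≤j xⁱ≈xʲ = identityʳ-unique (pow G x i) _ (begin
    pow G x i ∙ pow G x (j ∸ i) ≈⟨ pow-+ x i (j ∸ i) ⟨
    pow G x (i + (j ∸ i))       ≡⟨ ≡.cong (pow G x) (m+[n∸m]≡n i≤j) ⟩
    pow G x j                   ≈⟨ xⁱ≈xʲ ⟨
    pow G x i                   ∎)
    where open ≈-Reasoning setoid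

  module _ {x N} (ord : HasOrder G x N) where
    private instance _ = >-nonZero (proj₁ ord)

    ∣⇒pow≈ε : ∀ {k} → N ∣ k → pow G x k ≈ ε
    ∣⇒pow≈ε (divides q refl) =
      trans (pow-* x q N) (trans (pow-cong q (proj₁ (proj₂ ord))) (pow-ε q))

    pow-% : ∀ k → pow G x k ≈ pow G x (k % N)
    pow-% k = begin
      pow G x k                              ≡⟨ ≡.cong (pow G x) (m≡m%n+[m/n]*n k N) ⟩
      pow G x (k % N + k / N * N)            ≈⟨ pow-+ x (k % N) _ ⟩
      pow G x (k % N) ∙ pow G x (k / N * N)  ≈⟨ ∙-congˡ (∣⇒pow≈ε (n∣m*n (k / N))) ⟩
      pow G x (k % N) ∙ ε                    ≈⟨ identityʳ _ ⟩
      pow G x (k % N)                        ∎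
      where open ≈-Reasoning setoid

    <∧pow≈ε⇒≡0 : ∀ {k} → k < N → pow G x k ≈ ε → k ≡ 0
    <∧pow≈ε⇒≡0 {k} k<N xᵏ≈ε = n≤0⇒n≡0 (≮⇒≥ λ 0<k → proj₂ (proj₂ ord) k 0<k k<N xᵏ≈ε)

    pow≈ε⇒∣ : ∀ {k} → pow G x k ≈ ε → N ∣ k
    pow≈ε⇒∣ {k} xᵏ≈ε = m%n≡0⇒n∣m k N (<∧pow≈ε⇒≡0 (m%n<n k N) (trans (sym (pow-% k)) xᵏ≈ε))

    pow-injective-≤ : ∀ {i j} → i ≤ j → j < N → pow G x i ≈ pow G x j → i ≡ j
    pow-injective-≤ {i} {j} i≤j j<N xⁱ≈xʲ = ≤-antisym i≤j
      (m∸n≡0⇒m≤n (<∧pow≈ε⇒≡0 (≤-<-trans (m∸n≤m j i) j<N) (pow-∸ i≤j xⁱ≈xʲ)))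

    pow-injective : ∀ {i j} → i < N → j < N → pow G x i ≈ pow G x j → i ≡ j
    pow-injective {i} {j} i<N j<N xⁱ≈xʲ with ≤-total i j
    ... | inj₁ i≤j = pow-injective-≤ i≤j j<N xⁱ≈xʲ
    ... | inj₂ j≤i = ≡.sym (pow-injective-≤ j≤i i<N (sym xⁱ≈xʲ))

module _ {c ℓ} (G : Group c ℓ) {n} (e : Enumeration G n) where
  open Group G hiding (refl)
  open GroupProperties G using (//-rightDividesʳ)
  open Inverse e using (to; from; from-cong; strictlyInverseˡ; strictlyInverseʳ)

  from-injective : ∀ {x y} → from x ≡ from y → x ≈ y
  from-injective {x} eq = trans (sym (strictlyInverseˡ x)) (Inverse.inverseˡ e eq)

  to-injective : ∀ {i j} → to i ≈ to j → i ≡ j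
  to-injective {i} eq = ≡.trans (≡.sym (strictlyInverseʳ i)) (Inverse.inverseʳ e eq)

  _≈?_ : ∀ x y → Dec (x ≈ y)
  x ≈? y = map′ from-injective from-cong (from x Finₚ.≟ from y)

  ∃-pow≈ε : ∀ x → ∃ λ k → 0 < k × pow G x k ≈ ε
  ∃-pow≈ε x with pigeonhole (n<1+n n) (λ i → from (pow G x (toℕ i)))
  ... | i , j , i<j , eq = toℕ j ∸ toℕ i , m<n⇒0<n∸m i<j , pow-∸ G (<⇒≤ i<j) (from-injective eq)

  order-exists : ∀ x → ∃ (HasOrder G x)
  order-exists x with least (λ k → 0 <? k ×-dec pow G x k ≈? ε) (proj₂ (∃-pow≈ε x))
  ... | N , (0<N , xᴺ≈ε) , minimal = N , 0<N , xᴺ≈ε , λ k 0<k k<N xᵏ≈ε → minimal k<N (0<k , xᵏ≈ε)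

  generator-order : ∀ {g} → Generates G g → HasOrder G g n
  generator-order {g} gen with order-exists g
  ... | N , ord = ≡.subst (HasOrder G g) (≤-antisym N≤n n≤N) ord
    where
    instance _ = >-nonZero (proj₁ ord)
    exponent : Fin n → ℕ
    exponent j = proj₁ (gen (to j))
    N≤n : N ≤ n
    N≤n = injective⇒≤ {f = λ i → from (pow G g (toℕ i))}
      (toℕ-injective ∘ pow-injective G ord (toℕ<n _) (toℕ<n _) ∘ from-injective)
    n≤N : n ≤ N
    n≤N = injective⇒≤ {f = λ j → fromℕ< (m%n<n (exponent j) N)} λ {i} {j} eq →
      to-injective (begin
        to i                     ≈⟨ proj₂ (gen (to i)) ⟩
        pow G g (exponent i)     ≈⟨ pow-% G ord (exponent i) ⟩
        pow G g (exponent i % N) ≡⟨ ≡.cong (pow G g) (fromℕ<-injective _ _ _ _ eq) ⟩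
        pow G g (exponent j % N) ≈⟨ pow-% G ord (exponent j) ⟨
        pow G g (exponent j)     ≈⟨ proj₂ (gen (to j)) ⟨
        to j                     ∎)
      where open ≈-Reasoning setoid

  module SubgroupProperties {H} (H-sub : IsSubgroup G e H) where
    open IsSubgroup H-sub

    ∈-resp-≈ : ∀ {x y} → x ≈ y → _∈G_ G e x H → _∈G_ G e y H
    ∈-resp-≈ x≈y = ≡.subst (_∈ H) (from-cong x≈y)

    pow-closed : ∀ {x} k → _∈G_ G e x H → _∈G_ G e (pow G x k) H
    pow-closed zero    x∈H = ε-closed
    pow-closed (suc k) x∈H = ∙-closed _ _ x∈H (pow-closed k x∈H)

    ∈-cancelʳ : ∀ {x y} → _∈G_ G e (x ∙ y) H → _∈G_ G e y H → _∈G_ G e x H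
    ∈-cancelʳ {x} {y} xy∈H y∈H =
      ∈-resp-≈ (//-rightDividesʳ y x) (∙-closed _ _ xy∈H (⁻¹-closed y y∈H))

module Cyclic {c ℓ} (G : Group c ℓ) {n} (e : Enumeration G n) {g} (gen : Generates G g) where
  open Group G hiding (refl)
  open GroupProperties G using (inverseʳ-unique)
  open Inverse e using (to; from; strictlyInverseˡ; strictlyInverseʳ)

  order-g : HasOrder G g n
  order-g = generator-order G e gen

  instance
    n≢0 : NonZero n
    n≢0 = >-nonZero (proj₁ order-g)

  log : Carrier → ℕ
  log x = proj₁ (gen x) % n

  log<n : ∀ x → log x < n
  log<n x = m%n<n (proj₁ (gen x)) n

  pow-log : ∀ x → x ≈ pow G g (log x)
  pow-log x = trans (proj₂ (gen x)) (pow-% G order-g _)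

  log-unique : ∀ {x k} → k < n → x ≈ pow G g k → log x ≡ k
  log-unique {x} k<n x≈gᵏ = pow-injective G order-g (log<n x) k<n (trans (sym (pow-log x)) x≈gᵏ)

  log-≈ : ∀ {x} k → x ≈ pow G g k → log x ≡ k % n
  log-≈ k x≈gᵏ = log-unique (m%n<n k n) (trans x≈gᵏ (pow-% G order-g k))

  log-cong : ∀ {x y} → x ≈ y → log x ≡ log y
  log-cong {y = y} x≈y = log-unique (log<n y) (trans x≈y (pow-log y))

  log-ε : log ε ≡ 0
  log-ε = log-unique (>-nonZero⁻¹ n) (Group.refl G)

  log-∙ : ∀ x y → log (x ∙ y) ≡ (log x + log y) % n
  log-∙ x y = log-≈ (log x + log y)
    (trans (∙-cong (pow-log x) (pow-log y)) (sym (pow-+ G g (log x) (log y))))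

  log-⁻¹ : ∀ x → log (x ⁻¹) ≡ (n ∸ log x) % n
  log-⁻¹ x = log-≈ (n ∸ log x) (sym (inverseʳ-unique x _ (begin
    x ∙ pow G g (n ∸ log x)                ≈⟨ ∙-congʳ (pow-log x) ⟩
    pow G g (log x) ∙ pow G g (n ∸ log x)  ≈⟨ pow-+ G g (log x) _ ⟨
    pow G g (log x + (n ∸ log x))          ≡⟨ ≡.cong (pow G g) (m+[n∸m]≡n (<⇒≤ (log<n x))) ⟩
    pow G g n                              ≈⟨ proj₁ (proj₂ order-g) ⟩
    ε                                      ∎)))
    where open ≈-Reasoning setoid

  pow≈pow-log : ∀ x k → pow G x k ≈ pow G g (k * log x)
  pow≈pow-log x k = trans (pow-cong G k (pow-log x)) (sym (pow-* G g k (log x)))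

  module _ {a m} (order-a : HasOrder G a m) where

    order∣n : m ∣ n
    order∣n = pow≈ε⇒∣ G order-a (trans (pow≈pow-log a n) (∣⇒pow≈ε G order-g (m∣m*n (log a))))

    cofactor∣log : ∀ {q} → n ≡ m * q → q ∣ log a
    cofactor∣log {q} n≡mq = *-cancelˡ-∣ m {{>-nonZero (proj₁ order-a)}}
      (≡.subst (_∣ m * log a) n≡mq
        (pow≈ε⇒∣ G order-g (trans (sym (pow≈pow-log a m)) (proj₁ (proj₂ order-a)))))

    ∣log⇒order∣ : ∀ {d w} → n ≡ d * w → d ∣ log a → m ∣ w
    ∣log⇒order∣ {d} {w} n≡dw d∣log = pow≈ε⇒∣ G order-a
      (trans (pow≈pow-log a w) (∣⇒pow≈ε G order-g n∣w*log))
      where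
      n∣w*log : n ∣ w * log a
      n∣w*log = ≡.subst₂ _∣_ (≡.sym n≡dw) (*-comm (log a) w) (*-monoˡ-∣ w d∣log)

  private
    ∣log? : ∀ d (j : Fin n) → Dec (d ∣ log (to j))
    ∣log? d j = d ∣? log (to j)

  multiples : ℕ → Subset n
  multiples d = subsetOf (∣log? d)

  ∈-multiples⁺ : ∀ {d x} → d ∣ log x → _∈G_ G e x (multiples d)
  ∈-multiples⁺ {d} {x} d∣log =
    ∈-subsetOf⁺ (∣log? d) (≡.subst (d ∣_) (≡.sym (log-cong (strictlyInverseˡ x))) d∣log)

  ∈-multiples⁻ : ∀ {d x} → _∈G_ G e x (multiples d) → d ∣ log x
  ∈-multiples⁻ {d} {x} x∈ =
    ≡.subst (d ∣_) (log-cong (strictlyInverseˡ x)) (∈-subsetOf⁻ (∣log? d) x∈)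

  multiples-isSubgroup : ∀ {d} → d ∣ n → IsSubgroup G e (multiples d)
  multiples-isSubgroup {d} d∣n = record
    { ε-closed  = ∈-multiples⁺ (≡.subst (d ∣_) (≡.sym log-ε) (d ∣0))
    ; ∙-closed  = λ x y x∈ y∈ → ∈-multiples⁺ (≡.subst (d ∣_) (≡.sym (log-∙ x y))
        (%-presˡ-∣ (∣m∣n⇒∣m+n (∈-multiples⁻ x∈) (∈-multiples⁻ y∈)) d∣n))
    ; ⁻¹-closed = λ x x∈ → ∈-multiples⁺ (≡.subst (d ∣_) (≡.sym (log-⁻¹ x))
        (%-presˡ-∣ (∣m+n∣m⇒∣n (d∣log+[n∸log] x) (∈-multiples⁻ x∈)) d∣n))
    }
    where
    d∣log+[n∸log] : ∀ x → d ∣ log x + (n ∸ log x)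
    d∣log+[n∸log] x = ≡.subst (d ∣_) (≡.sym (m+[n∸m]≡n (<⇒≤ (log<n x)))) d∣n

  ∣multiples∣ : ∀ {d} → d ∣ n → ∣ multiples d ∣ * d ≡ n
  ∣multiples∣ {d} d∣n = ≡.trans (≡.cong (_* d) (≤-antisym upper lower)) (≡.sym n≡wd)
    where
    w = quotient d∣n
    n≡wd : n ≡ w * d
    n≡wd = m∣n⇒n≡quotient*m d∣n
    instance _ = m*n≢0⇒n≢0 w {{≡.subst NonZero n≡wd n≢0}}

    upper : ∣ multiples d ∣ ≤ w
    upper = injectiveOn⇒∣p∣≤
      (λ j → fromℕ< (m<n*o⇒m/o<n (≡.subst (log (to j) <_) n≡wd (log<n (to j)))))
      λ {i} {j} i∈ j∈ eq → to-injective G e (begin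
        to i                  ≈⟨ pow-log (to i) ⟩
        pow G g (log (to i))  ≡⟨ ≡.cong (pow G g) (/-cancelʳ-≡ (∈-subsetOf⁻ (∣log? d) i∈)
                                   (∈-subsetOf⁻ (∣log? d) j∈) (fromℕ<-injective _ _ _ _ eq)) ⟩
        pow G g (log (to j))  ≈⟨ pow-log (to j) ⟨
        to j                  ∎)
      where open ≈-Reasoning setoid

    i*d<n : ∀ (i : Fin w) → toℕ i * d < n
    i*d<n i = ≡.subst (toℕ i * d <_) (≡.sym n≡wd) (*-monoˡ-< d (toℕ<n i))

    lower : w ≤ ∣ multiples d ∣
    lower = injective⇒≤∣p∣ (λ i → from (pow G g (toℕ i * d)))
      (λ i → ∈-multiples⁺
        (≡.subst (d ∣_) (≡.sym (log-unique (i*d<n i) (Group.refl G))) (n∣m*n (toℕ i))))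
      λ {i} {j} eq → toℕ-injective (*-cancelʳ-≡ _ _ d
        (pow-injective G order-g (i*d<n i) (i*d<n j) (from-injective G e eq)))

  module _ {H} (H-sub : IsSubgroup G e H) where
    open IsSubgroup H-sub using (ε-closed)
    open SubgroupProperties G e H-sub

    private
      gⁿ∈H : _∈G_ G e (pow G g n) H
      gⁿ∈H = ∈-resp-≈ (sym (proj₁ (proj₂ order-g))) ε-closed

    -- abstract, so that type checking never normalises the well-founded search
    abstract
      least-exponent : ∃ (Least λ k → 0 < k × _∈G_ G e (pow G g k) H)
      least-exponent = least (λ k → 0 <? k ×-dec from (pow G g k) ∈? H) (proj₁ order-g , gⁿ∈H)

    index : ℕ
    index = proj₁ least-exponent

    index≢0 : NonZero index
    index≢0 = >-nonZero (proj₁ (proj₁ (proj₂ least-exponent)))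

    private
      instance _ = index≢0

      gⁱⁿᵈᵉˣ∈H : _∈G_ G e (pow G g index) H
      gⁱⁿᵈᵉˣ∈H = proj₂ (proj₁ (proj₂ least-exponent))

      multiple∈H : ∀ s → _∈G_ G e (pow G g (s * index)) H
      multiple∈H s = ∈-resp-≈ (sym (pow-* G g s index)) (pow-closed s gⁱⁿᵈᵉˣ∈H)

    index∣ : ∀ {k} → _∈G_ G e (pow G g k) H → index ∣ k
    index∣ {k} gᵏ∈H = m%n≡0⇒n∣m k index (n≤0⇒n≡0 (≮⇒≥ λ 0<r →
      proj₂ (proj₂ least-exponent) (m%n<n k index) (0<r , remainder∈H)))
      where
      gᵏ≈ : pow G g k ≈ pow G g (k % index) ∙ pow G g (k / index * index)
      gᵏ≈ = trans (reflexive (≡.cong (pow G g) (m≡m%n+[m/n]*n k index))) (pow-+ G g (k % index) _)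
      remainder∈H : _∈G_ G e (pow G g (k % index)) H
      remainder∈H = ∈-cancelʳ (∈-resp-≈ gᵏ≈ gᵏ∈H) (multiple∈H (k / index))

    index∣n : index ∣ n
    index∣n = index∣ gⁿ∈H

    ∈-index⁺ : ∀ {x} → index ∣ log x → _∈G_ G e x H
    ∈-index⁺ {x} (divides s log≡s*index) =
      ∈-resp-≈ (sym (trans (pow-log x) (reflexive (≡.cong (pow G g) log≡s*index)))) (multiple∈H s)

    ∈-index⁻ : ∀ {x} → _∈G_ G e x H → index ∣ log x
    ∈-index⁻ {x} = index∣ ∘ ∈-resp-≈ (pow-log x)

    subgroup≡multiples : H ≡ multiples index
    subgroup≡multiples = ⊆-antisym
      (λ {j} j∈H → ∈-subsetOf⁺ (∣log? index)
        (∈-index⁻ (≡.subst (_∈ H) (≡.sym (strictlyInverseʳ j)) j∈H)))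
      (λ {j} j∈ → ≡.subst (_∈ H) (strictlyInverseʳ j) (∈-index⁺ (∈-subsetOf⁻ (∣log? index) j∈)))

lemma6 : ∀ {c ℓ} (G : Group c ℓ) (n : ℕ) (e : Enumeration G n) →
    1 < n → IsCyclic G →
    (a : Group.Carrier G) → ¬ (Group._≈_ G a (Group.ε G)) →
    (m : ℕ) → HasOrder G a m →
    (H : Subset n) → IsSubgroup G e H → ¬ (_∈G_ G e a H) →
    (∀ (K : Subset n) → IsSubgroup G e K → ¬ (_∈G_ G e a K) → ∣ K ∣ ≤ ∣ H ∣) →
    (v : ℕ) → IsScriptP n m v →
    v * ∣ H ∣ ≡ n
lemma6 G n e _ (_ , gen) a _ m order-a H H-sub a∉H H-maximal v 𝒫 = ≤-antisym upper lower
  where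
  open Cyclic G e gen
  instance
    _ = >-nonZero (proj₁ order-a)
    _ = index≢0 H-sub

  c = index H-sub
  q = quotient (order∣n order-a)

  n≡mq : n ≡ m * q
  n≡mq = m∣n⇒n≡m*quotient (order∣n order-a)

  c∤q : ¬ c ∣ q
  c∤q c∣q = a∉H (∈-index⁺ H-sub (∣-trans c∣q (cofactor∣log order-a n≡mq)))

  upper : v * ∣ H ∣ ≤ n
  upper = begin
    v * ∣ H ∣            ≤⟨ *-monoˡ-≤ ∣ H ∣ (scriptP-≤ n≡mq (index∣n H-sub) c∤q 𝒫) ⟩
    c * ∣ H ∣            ≡⟨ ≡.cong (λ K → c * ∣ K ∣) (subgroup≡multiples H-sub) ⟩
    c * ∣ multiples c ∣  ≡⟨ *-comm c _ ⟩
    ∣ multiples c ∣ * c  ≡⟨ ∣multiples∣ (index∣n H-sub) ⟩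
    n                    ∎
    where open ≤-Reasoning

  cofactor : ∃ λ w → n ≡ v * w × ¬ m ∣ w
  cofactor = scriptPTerm-cofactor (order∣n order-a) (proj₂ (proj₁ 𝒫))

  w = proj₁ cofactor
  n≡vw = proj₁ (proj₂ cofactor)
  m∤w = proj₂ (proj₂ cofactor)

  v∣n : v ∣ n
  v∣n = divides w (≡.trans n≡vw (*-comm v w))

  a∉multiples-v : ¬ _∈G_ G e a (multiples v)
  a∉multiples-v = m∤w ∘ ∣log⇒order∣ order-a n≡vw ∘ ∈-multiples⁻ {v}

  lower : n ≤ v * ∣ H ∣
  lower = begin
    n                    ≡⟨ ∣multiples∣ v∣n ⟨
    ∣ multiples v ∣ * v  ≡⟨ *-comm _ v ⟩
    v * ∣ multiples v ∣  ≤⟨ *-monoʳ-≤ v (H-maximal _ (multiples-isSubgroup v∣n) a∉multiples-v) ⟩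
    v * ∣ H ∣            ∎
    where open ≤-Reasoning
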